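{- Let $f=(a,b,c,d)$ be a binary cubic form over $\mathbb{F}_q[t]$ with discriminant $D$ and imaginary or unusual Hessian $H_f=(P,Q,R)$, and let $U=2b^3+27a^2d-9abc$. Then $|U|^2\le|P|^3$ and $|a^2D|\le|P|^3$.
   Context: Let $q$ be a power of a prime $p\ge5$. For nonzero $H\in\mathbb{F}_q[t]$ put $|H|=q^{\deg H}$ and $|0|=0$; $\mathrm{sgn}(H)$ is the leading coefficient. A binary cubic form $(a,b,c,d)$ is $ax^3+bx^2y+cxy^2+dy^3$ with coefficients in $\mathbb{F}_q[t]$, with discriminant $D=18abcd+b^2c^2-4ac^3-4b^3d-27a^2d^2$ (assumed nonzero). Its Hessian is $(P,Q,R)$ with $P=b^2-3ac$, $Q=bc-9ad$, $R=c^2-3bd$, a binary quadratic form of discriminant $Q^2-4PR=-3D$. The Hessian is imaginary if $\deg(-3D)$ is odd, and unusual if $\deg(-3D)$ is even and $\mathrm{sgn}(-3D)$ is a non-square in $\mathbb{F}_q^*$. -}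

module Defs where

open import Data.Nat as ℕ using (ℕ; zero; suc)
open import Data.Product using (Σ; _×_; _,_; ∃)
open import Data.Maybe using (Maybe; just; nothing)
open import Data.List using (List; []; _∷_)
open import Relation.Nullary using (¬_; Dec; yes; no)
open import Relation.Binary.PropositionalEquality using (_≡_; _≢_)
open import Algebra.Structures using (IsCommutativeRing)

record Field : Set₁ where
  infixl 6 _+_
  infixl 7 _*_
  field
    Carrier : Set
    _+_ _*_ : Carrier → Carrier → Carrier
    -_ : Carrier → Carrier
    0# 1# : Carrier
    isCommutativeRing : IsCommutativeRing _≡_ _+_ _*_ -_ 0# 1#
    0≢1 : 0# ≢ 1#
    inverse : ∀ x → x ≢ 0# → ∃ λ y → x * y ≡ 1#
    _≟_ : (x y : Carrier) → Dec (x ≡ y)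

module Poly (F : Field) where
  open Field F

  -- Polynomials in F[t]: coefficient lists, constant term first
  -- (trailing zero coefficients allowed; degree ignores them).
  Pol : Set
  Pol = List Carrier

  const : Carrier → Pol
  const c = c ∷ []

  natF : ℕ → Carrier
  natF zero = 0#
  natF (suc n) = 1# + natF n

  infixl 6 _⊕_
  infixl 7 _⊗_

  _⊕_ : Pol → Pol → Pol
  [] ⊕ ys = ys
  (x ∷ xs) ⊕ [] = x ∷ xs
  (x ∷ xs) ⊕ (y ∷ ys) = (x + y) ∷ (xs ⊕ ys)

  scale : Carrier → Pol → Pol
  scale c [] = []
  scale c (y ∷ ys) = (c * y) ∷ scale c ys

  _⊗_ : Pol → Pol → Pol
  [] ⊗ ys = []
  (x ∷ xs) ⊗ ys = scale x ys ⊕ (0# ∷ (xs ⊗ ys))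

  _·_ : ℕ → Pol → Pol
  n · P = scale (natF n) P

  neg : Pol → Pol
  neg P = scale (- 1#) P

  -- degree and leading coefficient; nothing for the zero polynomial
  lead : Pol → Maybe (ℕ × Carrier)
  lead [] = nothing
  lead (x ∷ xs) with lead xs
  ... | just (n , c) = just (suc n , c)
  ... | nothing with x ≟ 0#
  ...   | yes _ = nothing
  ...   | no _ = just (0 , x)

  IsZeroPol : Pol → Set
  IsZeroPol H = lead H ≡ nothing

  absv : ℕ → Pol → ℕ
  absv q H with lead H
  ... | nothing = 0
  ... | just (n , _) = q ℕ.^ n

  IsSquare : Carrier → Set
  IsSquare c = ∃ λ x → x * x ≡ c

  OddDegree : Pol → Set
  OddDegree H = ∃ λ m → ∃ λ c → lead H ≡ just (suc (2 ℕ.* m) , c)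

  EvenDegreeNonSquareSign : Pol → Set
  EvenDegreeNonSquareSign H =
    ∃ λ m → ∃ λ c → lead H ≡ just (2 ℕ.* m , c) × ¬ IsSquare c

  disc : Pol → Pol → Pol → Pol → Pol
  disc a b c d =
    (18 · (a ⊗ b ⊗ c ⊗ d)) ⊕ (b ⊗ b ⊗ c ⊗ c)
    ⊕ neg (4 · (a ⊗ c ⊗ c ⊗ c)) ⊕ neg (4 · (b ⊗ b ⊗ b ⊗ d))
    ⊕ neg (27 · (a ⊗ a ⊗ d ⊗ d))

  hesP hesQ hesR : Pol → Pol → Pol → Pol → Pol
  hesP a b c d = (b ⊗ b) ⊕ neg (3 · (a ⊗ c))
  hesQ a b c d = (b ⊗ c) ⊕ neg (9 · (a ⊗ d))
  hesR a b c d = (c ⊗ c) ⊕ neg (3 · (b ⊗ d))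

  hesDisc : Pol → Pol → Pol → Pol → Pol
  hesDisc a b c d = neg (3 · disc a b c d)

  HessianImaginary HessianUnusual : Pol → Pol → Pol → Pol → Set
  HessianImaginary a b c d = OddDegree (hesDisc a b c d)
  HessianUnusual a b c d = EvenDegreeNonSquareSign (hesDisc a b c d)

  Uf : Pol → Pol → Pol → Pol → Pol
  Uf a b c d = (2 · (b ⊗ b ⊗ b)) ⊕ (27 · (a ⊗ a ⊗ d)) ⊕ neg (9 · (a ⊗ b ⊗ c))

-- The Hessian satisfies the syzygy 4P³ = U² + 27a²D = U² − 9a²Δ, where Δ = −3D. The leading
-- terms of U² and 9a²Δ cannot cancel: if deg Δ is odd their degrees have different parity, and
-- if deg Δ is even, u² = 9α²·sgn Δ for the leading coefficients u of U and α of a would make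
-- sgn Δ the square of u/3α. So deg 4P³ ≥ max(2 deg U, 2 deg a + deg D), while scaling by 4 can
-- only lower the degree of P³; both bounds follow.
module Submission where

open import Defs
open import Algebra.Bundles using (CommutativeRing; CommutativeSemigroup)
import Algebra.Properties.CommutativeSemigroup as CommutativeSemigroupProperties
import Algebra.Properties.Ring as RingProperties
import Algebra.Properties.Semiring.Mult as SemiringMultiplication
import Algebra.Solver.Ring as RingSolver
open import Algebra.Solver.Ring.AlmostCommutativeRing
  using (AlmostCommutativeRing; fromCommutativeRing; _-Raw-AlmostCommutative⟶_; Induced-equivalence)
open import Data.Empty using (⊥; ⊥-elim)
open import Data.Fin using (Fin)
open import Data.Integer as ℤ using (ℤ; -[1+_]; _⊖_)
import Data.Integer.Properties as ℤ
open import Data.List using ([]; _∷_)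
open import Data.Maybe using (Maybe; just; nothing)
open import Data.Nat as ℕ using (ℕ; zero; suc; _≤_; _^_)
import Data.Nat.Properties as ℕ
open import Data.Nat.Primality using (Prime)
open import Data.Nat.Tactic.RingSolver using (solve-∀)
open import Data.Product using (_,_; _×_; ∃; ∃₂)
open import Data.Sign as Sign using (Sign)
open import Data.Sum using (_⊎_; inj₁; inj₂)
open import Function using (case_of_)
open import Function.Bundles using (_↔_)
open import Relation.Binary.Bundles using (Setoid)
open import Relation.Binary.Definitions using (WeaklyDecidable; tri<; tri≈; tri>)
open import Relation.Binary.PropositionalEquality
import Relation.Binary.Reasoning.Setoid as SetoidReasoning
open import Relation.Binary.Structures using (IsEquivalence)
open import Relation.Nullary using (yes; no; ¬_)

-- Integer coefficients normalise by computation, so both sides of an identity with numeric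
-- constants reach literally the same normal form (9 and 3 · 3 alike).
module ℤ-Solver {c ℓ} (R : AlmostCommutativeRing c ℓ) (ℤ⟶R : ℤ.+-*-rawRing -Raw-AlmostCommutative⟶ R) where
  ℤ-coeff≟ : WeaklyDecidable (Induced-equivalence ℤ⟶R)
  ℤ-coeff≟ i j with i ℤ.≟ j
  ... | yes refl = just (AlmostCommutativeRing.refl R)
  ... | no _       = nothing

  open RingSolver ℤ.+-*-rawRing R ℤ⟶R ℤ-coeff≟ public

module FieldArithmetic (F : Field) where
  open Field F
  open Poly F using (natF; IsSquare)

  commutativeRing : CommutativeRing _ _
  commutativeRing = record { isCommutativeRing = isCommutativeRing }

  open CommutativeRing commutativeRing
    using (+-assoc; +-comm; +-identityˡ; +-identityʳ; -‿inverseʳ; *-assoc; *-comm; *-identityˡ; *-identityʳ;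
           zeroʳ; semiring; ring)
    renaming (+-commutativeSemigroup to +-cs; *-commutativeSemigroup to *-cs)
  open RingProperties ring using (-1*x≈-x; -‿involutive; -0#≈0#; -‿+-comm; -‿distribʳ-*; x∙y⁻¹≈ε⇒x≈y)
  open SemiringMultiplication semiring using (×-homo-+; ×1-homo-*) renaming (_×_ to _×ₙ_)
  open CommutativeSemigroupProperties +-cs using () renaming (interchange to +-interchange)
  open CommutativeSemigroupProperties *-cs using () renaming (interchange to *-interchange)
  open ≡-Reasoning

  natF≡×1 : ∀ n → natF n ≡ n ×ₙ 1#
  natF≡×1 zero    = refl
  natF≡×1 (suc n) = cong (1# +_) (natF≡×1 n)

  natF-+ : ∀ m n → natF (m ℕ.+ n) ≡ natF m + natF n
  natF-+ m n rewrite natF≡×1 (m ℕ.+ n) | natF≡×1 m | natF≡×1 n = ×-homo-+ 1# m n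

  natF-* : ∀ m n → natF (m ℕ.* n) ≡ natF m * natF n
  natF-* m n rewrite natF≡×1 (m ℕ.* n) | natF≡×1 m | natF≡×1 n = ×1-homo-* m n

  ℤ→F : ℤ → Carrier
  ℤ→F (ℤ.+ n)  = natF n
  ℤ→F -[1+ n ] = - natF (suc n)

  natF-suc-− : ∀ m n → natF (suc m) + - natF (suc n) ≡ natF m + - natF n
  natF-suc-− m n = begin
    (1# + natF m) + - (1# + natF n)       ≡⟨ cong ((1# + natF m) +_) (-‿+-comm 1# (natF n)) ⟨
    (1# + natF m) + (- 1# + - natF n)     ≡⟨ +-interchange 1# (natF m) (- 1#) (- natF n) ⟩
    (1# + - 1#) + (natF m + - natF n)     ≡⟨ cong (_+ (natF m + - natF n)) (-‿inverseʳ 1#) ⟩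
    0# + (natF m + - natF n)              ≡⟨ +-identityˡ _ ⟩
    natF m + - natF n                     ∎

  ℤ→F-⊖ : ∀ m n → ℤ→F (m ⊖ n) ≡ natF m + - natF n
  ℤ→F-⊖ m       zero    = sym (trans (cong (natF m +_) -0#≈0#) (+-identityʳ _))
  ℤ→F-⊖ zero    (suc n) = sym (+-identityˡ _)
  ℤ→F-⊖ (suc m) (suc n) = begin
    ℤ→F (suc m ⊖ suc n)        ≡⟨ cong ℤ→F (ℤ.[1+m]⊖[1+n]≡m⊖n m n) ⟩
    ℤ→F (m ⊖ n)                ≡⟨ ℤ→F-⊖ m n ⟩
    natF m + - natF n          ≡⟨ natF-suc-− m n ⟨
    natF (suc m) + - natF (suc n) ∎

  ℤ→F-+ : ∀ i j → ℤ→F (i ℤ.+ j) ≡ ℤ→F i + ℤ→F j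
  ℤ→F-+ (ℤ.+ m)   (ℤ.+ n)   = natF-+ m n
  ℤ→F-+ (ℤ.+ m)   -[1+ n ]  = ℤ→F-⊖ m (suc n)
  ℤ→F-+ -[1+ m ]  (ℤ.+ n)   = trans (ℤ→F-⊖ n (suc m)) (+-comm _ _)
  ℤ→F-+ -[1+ m ]  -[1+ n ]  = begin
    - (1# + natF (suc (m ℕ.+ n)))         ≡⟨ cong (λ k → - natF (suc k)) (ℕ.+-suc m n) ⟨
    - natF (suc (m ℕ.+ suc n))            ≡⟨ cong (λ x → - (1# + x)) (natF-+ m (suc n)) ⟩
    - (1# + (natF m + natF (suc n)))      ≡⟨ cong -_ (+-assoc 1# (natF m) _) ⟨
    - (natF (suc m) + natF (suc n))       ≡⟨ -‿+-comm _ _ ⟨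
    - natF (suc m) + - natF (suc n)       ∎

  ℤ→F-neg : ∀ i → ℤ→F (ℤ.- i) ≡ - ℤ→F i
  ℤ→F-neg (ℤ.+ zero)  = sym -0#≈0#
  ℤ→F-neg (ℤ.+ suc n) = refl
  ℤ→F-neg -[1+ n ]    = sym (-‿involutive _)

  signF : Sign → Carrier
  signF Sign.+ = 1#
  signF Sign.- = - 1#

  signF-* : ∀ s t → signF (s Sign.* t) ≡ signF s * signF t
  signF-* Sign.+ t      = sym (*-identityˡ _)
  signF-* Sign.- Sign.+ = sym (*-identityʳ _)
  signF-* Sign.- Sign.- = begin
    1#             ≡⟨ -‿involutive 1# ⟨
    - (- 1#)       ≡⟨ cong -_ (-1*x≈-x 1#) ⟨
    - (- 1# * 1#)  ≡⟨ -‿distribʳ-* _ _ ⟩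
    - 1# * - 1#    ∎

  ℤ→F-◃ : ∀ s n → ℤ→F (s ℤ.◃ n) ≡ signF s * natF n
  ℤ→F-◃ s       zero    = sym (zeroʳ _)
  ℤ→F-◃ Sign.+ (suc n) = sym (*-identityˡ _)
  ℤ→F-◃ Sign.- (suc n) = sym (-1*x≈-x _)

  ℤ→F-sign-abs : ∀ i → ℤ→F i ≡ signF (ℤ.sign i) * natF ℤ.∣ i ∣
  ℤ→F-sign-abs i = trans (cong ℤ→F (sym (ℤ.◃-inverse i))) (ℤ→F-◃ (ℤ.sign i) ℤ.∣ i ∣)

  ℤ→F-* : ∀ i j → ℤ→F (i ℤ.* j) ≡ ℤ→F i * ℤ→F j
  ℤ→F-* i j = begin
    ℤ→F (i ℤ.* j)                                          ≡⟨ ℤ→F-◃ (ℤ.sign i Sign.* ℤ.sign j) (ℤ.∣ i ∣ ℕ.* ℤ.∣ j ∣) ⟩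
    signF (ℤ.sign i Sign.* ℤ.sign j) * natF (ℤ.∣ i ∣ ℕ.* ℤ.∣ j ∣) ≡⟨ cong₂ _*_ (signF-* (ℤ.sign i) (ℤ.sign j)) (natF-* ℤ.∣ i ∣ ℤ.∣ j ∣) ⟩
    (signF (ℤ.sign i) * signF (ℤ.sign j)) * (natF ℤ.∣ i ∣ * natF ℤ.∣ j ∣) ≡⟨ *-interchange (signF (ℤ.sign i)) _ _ _ ⟩
    (signF (ℤ.sign i) * natF ℤ.∣ i ∣) * (signF (ℤ.sign j) * natF ℤ.∣ j ∣) ≡⟨ cong₂ _*_ (ℤ→F-sign-abs i) (ℤ→F-sign-abs j) ⟨
    ℤ→F i * ℤ→F j                                          ∎

  ℤ⟶F : ℤ.+-*-rawRing -Raw-AlmostCommutative⟶ fromCommutativeRing commutativeRing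
  ℤ⟶F = record
    { ⟦_⟧    = ℤ→F
    ; +-homo = ℤ→F-+
    ; *-homo = ℤ→F-*
    ; -‿homo = ℤ→F-neg
    ; 0-homo = refl
    ; 1-homo = +-identityʳ 1#
    }

  module F-Solver = ℤ-Solver (fromCommutativeRing commutativeRing) ℤ⟶F

  *-nonzero : ∀ {x y} → x ≢ 0# → y ≢ 0# → x * y ≢ 0#
  *-nonzero {x} {y} x≢0 y≢0 xy≡0 with inverse x x≢0
  ... | x⁻¹ , xx⁻¹≡1 = y≢0 (begin
    y                ≡⟨ *-identityˡ y ⟨
    1# * y           ≡⟨ cong (_* y) (trans (sym xx⁻¹≡1) (*-comm x x⁻¹)) ⟩
    (x⁻¹ * x) * y    ≡⟨ *-assoc x⁻¹ x y ⟩
    x⁻¹ * (x * y)    ≡⟨ cong (x⁻¹ *_) xy≡0 ⟩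
    x⁻¹ * 0#         ≡⟨ zeroʳ x⁻¹ ⟩
    0#               ∎)

  x+-1*y≡0⇒x≡y : ∀ {x y} → x + - 1# * y ≡ 0# → x ≡ y
  x+-1*y≡0⇒x≡y {x} {y} eq = x∙y⁻¹≈ε⇒x≈y x y (trans (cong (x +_) (sym (-1*x≈-x y))) eq)

  -1#≢0# : - 1# ≢ 0#
  -1#≢0# -1≡0 = 0≢1 (begin
    0#          ≡⟨ -0#≈0# ⟨
    - 0#        ≡⟨ cong -_ -1≡0 ⟨
    - (- 1#)    ≡⟨ -‿involutive 1# ⟩
    1#          ∎)

  u*u≡9*a*a*c⇒IsSquare : ∀ {u a c} → natF 3 ≢ 0# → a ≢ 0# →
                        u * u ≡ natF 9 * ((a * a) * c) → IsSquare c
  u*u≡9*a*a*c⇒IsSquare {u} {a} {c} 3≢0 a≢0 u²≡9a²c with inverse (natF 3 * a) (*-nonzero 3≢0 a≢0)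
  ... | w , 3aw≡1 = u * w , (begin
    (u * w) * (u * w)                            ≡⟨ solve 2 (λ u w → (u :* w) :* (u :* w) := (u :* u) :* (w :* w)) refl u w ⟩
    (u * u) * (w * w)                            ≡⟨ cong (_* (w * w)) u²≡9a²c ⟩
    (natF 9 * ((a * a) * c)) * (w * w)           ≡⟨ solve 3 (λ a c w → (con (ℤ.+ 9) :* ((a :* a) :* c)) :* (w :* w)
                                                       := c :* (((con (ℤ.+ 3) :* a) :* w) :* ((con (ℤ.+ 3) :* a) :* w))) refl a c w ⟩
    c * (((natF 3 * a) * w) * ((natF 3 * a) * w)) ≡⟨ cong (λ x → c * (x * x)) 3aw≡1 ⟩
    c * (1# * 1#)                                ≡⟨ cong (c *_) (*-identityˡ 1#) ⟩
    c * 1#                                       ≡⟨ *-identityʳ c ⟩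
    c                                            ∎)
    where open F-Solver


module PolynomialRing (F : Field) where
  open Field F
  open Poly F
  open FieldArithmetic F
  open CommutativeRing commutativeRing
    using (+-assoc; +-comm; +-identityˡ; +-identityʳ; -‿inverseˡ;
           *-assoc; *-comm; *-identityˡ; distribˡ; distribʳ; zeroˡ; zeroʳ; ring)
  open RingProperties ring using (-1*x≈-x)

  coeff : ℕ → Pol → Carrier
  coeff n       []       = 0#
  coeff zero    (x ∷ xs) = x
  coeff (suc n) (x ∷ xs) = coeff n xs

  -- Coefficient lists may end in zeros, so polynomials are compared coefficientwise.
  infix 4 _≈ₚ_
  record _≈ₚ_ (xs ys : Pol) : Set where
    constructor coeffwise
    field coeff-≡ : ∀ n → coeff n xs ≡ coeff n ys
  open _≈ₚ_ public

  ≈ₚ-isEquivalence : IsEquivalence _≈ₚ_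
  ≈ₚ-isEquivalence = record
    { refl  = coeffwise λ _ → refl
    ; sym   = λ p → coeffwise λ n → sym (coeff-≡ p n)
    ; trans = λ p q → coeffwise λ n → trans (coeff-≡ p n) (coeff-≡ q n)
    }
  open IsEquivalence ≈ₚ-isEquivalence public
    using () renaming (refl to ≈ₚ-refl; sym to ≈ₚ-sym; trans to ≈ₚ-trans)

  ≈ₚ-setoid : Setoid _ _
  ≈ₚ-setoid = record { isEquivalence = ≈ₚ-isEquivalence }

  IsZero : Pol → Set
  IsZero xs = [] ≈ₚ xs

  coeff-⊕ : ∀ xs ys n → coeff n (xs ⊕ ys) ≡ coeff n xs + coeff n ys
  coeff-⊕ []       ys       n       = sym (+-identityˡ _)
  coeff-⊕ (x ∷ xs) []       n       = sym (+-identityʳ _)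
  coeff-⊕ (x ∷ xs) (y ∷ ys) zero    = refl
  coeff-⊕ (x ∷ xs) (y ∷ ys) (suc n) = coeff-⊕ xs ys n

  coeff-scale : ∀ c xs n → coeff n (scale c xs) ≡ c * coeff n xs
  coeff-scale c []       n       = sym (zeroʳ c)
  coeff-scale c (x ∷ xs) zero    = refl
  coeff-scale c (x ∷ xs) (suc n) = coeff-scale c xs n

  coeff-neg : ∀ xs n → coeff n (neg xs) ≡ - coeff n xs
  coeff-neg xs n = trans (coeff-scale (- 1#) xs n) (-1*x≈-x _)

  coeff-⊗-∷ : ∀ x xs ys n →
    coeff (suc n) ((x ∷ xs) ⊗ ys) ≡ x * coeff (suc n) ys + coeff n (xs ⊗ ys)
  coeff-⊗-∷ x xs ys n = trans (coeff-⊕ (scale x ys) _ (suc n)) (cong (_+ _) (coeff-scale x ys (suc n)))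

  ∷-cong : ∀ {x y xs ys} → x ≡ y → xs ≈ₚ ys → x ∷ xs ≈ₚ y ∷ ys
  ∷-cong x≡y xs≈ys = coeffwise λ { zero → x≡y ; (suc n) → coeff-≡ xs≈ys n }

  ∷-tail : ∀ {x y xs ys} → x ∷ xs ≈ₚ y ∷ ys → xs ≈ₚ ys
  ∷-tail p = coeffwise λ n → coeff-≡ p (suc n)

  ⊕-cong : ∀ {xs ys us vs} → xs ≈ₚ ys → us ≈ₚ vs → xs ⊕ us ≈ₚ ys ⊕ vs
  ⊕-cong {xs} {ys} {us} {vs} p q = coeffwise λ n → begin
    coeff n (xs ⊕ us)           ≡⟨ coeff-⊕ xs us n ⟩
    coeff n xs + coeff n us     ≡⟨ cong₂ _+_ (coeff-≡ p n) (coeff-≡ q n) ⟩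
    coeff n ys + coeff n vs     ≡⟨ coeff-⊕ ys vs n ⟨
    coeff n (ys ⊕ vs)           ∎
    where open ≡-Reasoning

  scale-cong : ∀ c {xs ys} → xs ≈ₚ ys → scale c xs ≈ₚ scale c ys
  scale-cong c {xs} {ys} p = coeffwise λ n →
    trans (coeff-scale c xs n) (trans (cong (c *_) (coeff-≡ p n)) (sym (coeff-scale c ys n)))

  neg-cong : ∀ {xs ys} → xs ≈ₚ ys → neg xs ≈ₚ neg ys
  neg-cong = scale-cong (- 1#)

  ⊕-assoc : ∀ xs ys zs → (xs ⊕ ys) ⊕ zs ≈ₚ xs ⊕ (ys ⊕ zs)
  ⊕-assoc xs ys zs = coeffwise λ n → begin
    coeff n ((xs ⊕ ys) ⊕ zs)               ≡⟨ coeff-⊕ (xs ⊕ ys) zs n ⟩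
    coeff n (xs ⊕ ys) + coeff n zs         ≡⟨ cong (_+ coeff n zs) (coeff-⊕ xs ys n) ⟩
    (coeff n xs + coeff n ys) + coeff n zs ≡⟨ +-assoc _ _ _ ⟩
    coeff n xs + (coeff n ys + coeff n zs) ≡⟨ cong (_+_ (coeff n xs)) (coeff-⊕ ys zs n) ⟨
    coeff n xs + coeff n (ys ⊕ zs)         ≡⟨ coeff-⊕ xs (ys ⊕ zs) n ⟨
    coeff n (xs ⊕ (ys ⊕ zs))               ∎
    where open ≡-Reasoning

  ⊕-comm : ∀ xs ys → xs ⊕ ys ≈ₚ ys ⊕ xs
  ⊕-comm xs ys = coeffwise λ n →
    trans (coeff-⊕ xs ys n) (trans (+-comm _ _) (sym (coeff-⊕ ys xs n)))

  ⊕-identityʳ : ∀ xs → xs ⊕ [] ≈ₚ xs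
  ⊕-identityʳ xs = coeffwise λ n → trans (coeff-⊕ xs [] n) (+-identityʳ _)

  neg-inverseˡ : ∀ xs → neg xs ⊕ xs ≈ₚ []
  neg-inverseˡ xs = coeffwise λ n →
    trans (coeff-⊕ (neg xs) xs n) (trans (cong (_+ coeff n xs) (coeff-neg xs n)) (-‿inverseˡ _))

  neg-inverseʳ : ∀ xs → xs ⊕ neg xs ≈ₚ []
  neg-inverseʳ xs = ≈ₚ-trans (⊕-comm xs (neg xs)) (neg-inverseˡ xs)

  ⊕-commutativeSemigroup : CommutativeSemigroup _ _
  ⊕-commutativeSemigroup = record
    { _≈_ = _≈ₚ_
    ; _∙_ = _⊕_
    ; isCommutativeSemigroup = record
      { isSemigroup = record
        { isMagma = record { isEquivalence = ≈ₚ-isEquivalence ; ∙-cong = ⊕-cong }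
        ; assoc   = ⊕-assoc
        }
      ; comm = ⊕-comm
      }
    }
  open CommutativeSemigroupProperties ⊕-commutativeSemigroup using () renaming (interchange to ⊕-interchange)

  scale-distribʳ : ∀ x y zs → scale (x + y) zs ≈ₚ scale x zs ⊕ scale y zs
  scale-distribʳ x y zs = coeffwise λ n → begin
    coeff n (scale (x + y) zs)                     ≡⟨ coeff-scale (x + y) zs n ⟩
    (x + y) * coeff n zs                           ≡⟨ distribʳ _ x y ⟩
    x * coeff n zs + y * coeff n zs                ≡⟨ cong₂ _+_ (coeff-scale x zs n) (coeff-scale y zs n) ⟨
    coeff n (scale x zs) + coeff n (scale y zs)    ≡⟨ coeff-⊕ (scale x zs) (scale y zs) n ⟨
    coeff n (scale x zs ⊕ scale y zs)              ∎
    where open ≡-Reasoning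

  scale-distribˡ : ∀ c xs ys → scale c (xs ⊕ ys) ≈ₚ scale c xs ⊕ scale c ys
  scale-distribˡ c xs ys = coeffwise λ n → begin
    coeff n (scale c (xs ⊕ ys))                    ≡⟨ coeff-scale c (xs ⊕ ys) n ⟩
    c * coeff n (xs ⊕ ys)                          ≡⟨ cong (c *_) (coeff-⊕ xs ys n) ⟩
    c * (coeff n xs + coeff n ys)                  ≡⟨ distribˡ c _ _ ⟩
    c * coeff n xs + c * coeff n ys                ≡⟨ cong₂ _+_ (coeff-scale c xs n) (coeff-scale c ys n) ⟨
    coeff n (scale c xs) + coeff n (scale c ys)    ≡⟨ coeff-⊕ (scale c xs) (scale c ys) n ⟨
    coeff n (scale c xs ⊕ scale c ys)              ∎
    where open ≡-Reasoning

  scale-* : ∀ c x ys → scale (c * x) ys ≈ₚ scale c (scale x ys)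
  scale-* c x ys = coeffwise λ n → begin
    coeff n (scale (c * x) ys)     ≡⟨ coeff-scale (c * x) ys n ⟩
    (c * x) * coeff n ys           ≡⟨ *-assoc c x _ ⟩
    c * (x * coeff n ys)           ≡⟨ cong (c *_) (coeff-scale x ys n) ⟨
    c * coeff n (scale x ys)       ≡⟨ coeff-scale c (scale x ys) n ⟨
    coeff n (scale c (scale x ys)) ∎
    where open ≡-Reasoning

  scale-0# : ∀ xs → IsZero (scale 0# xs)
  scale-0# xs = coeffwise λ n → sym (trans (coeff-scale 0# xs n) (zeroˡ _))

  scale-1# : ∀ xs → scale 1# xs ≈ₚ xs
  scale-1# xs = coeffwise λ n → trans (coeff-scale 1# xs n) (*-identityˡ _)

  0∷-⊕ : ∀ xs ys → 0# ∷ (xs ⊕ ys) ≈ₚ (0# ∷ xs) ⊕ (0# ∷ ys)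
  0∷-⊕ xs ys = ∷-cong (sym (+-identityˡ 0#)) ≈ₚ-refl

  0∷-scale : ∀ c xs → 0# ∷ scale c xs ≈ₚ scale c (0# ∷ xs)
  0∷-scale c xs = ∷-cong (sym (zeroʳ c)) ≈ₚ-refl

  IsZero-0∷ : ∀ {xs} → IsZero xs → IsZero (0# ∷ xs)
  IsZero-0∷ z = coeffwise λ { zero → refl ; (suc n) → coeff-≡ z n }

  IsZero-tail : ∀ {x xs} → IsZero (x ∷ xs) → IsZero xs
  IsZero-tail z = coeffwise λ n → coeff-≡ z (suc n)

  0∷-⊗ : ∀ xs ys → (0# ∷ xs) ⊗ ys ≈ₚ 0# ∷ (xs ⊗ ys)
  0∷-⊗ xs ys = ⊕-cong (≈ₚ-sym (scale-0# ys)) ≈ₚ-refl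

  ⊗-zeroˡ : ∀ {xs} ys → IsZero xs → IsZero (xs ⊗ ys)
  ⊗-zeroˡ {[]}     ys z = ≈ₚ-refl
  ⊗-zeroˡ {x ∷ xs} ys z rewrite sym (coeff-≡ z zero) =
    ≈ₚ-trans (IsZero-0∷ (⊗-zeroˡ ys (IsZero-tail z))) (≈ₚ-sym (0∷-⊗ xs ys))

  scale-congˡ : ∀ {c d} xs → c ≡ d → scale c xs ≈ₚ scale d xs
  scale-congˡ xs refl = ≈ₚ-refl

  ⊗-congˡ : ∀ {xs ys} zs → xs ≈ₚ ys → xs ⊗ zs ≈ₚ ys ⊗ zs
  ⊗-congˡ {[]}     {ys}     zs p = ⊗-zeroˡ zs p
  ⊗-congˡ {x ∷ xs} {[]}     zs p = ≈ₚ-sym (⊗-zeroˡ zs (≈ₚ-sym p))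
  ⊗-congˡ {x ∷ xs} {y ∷ ys} zs p =
    ⊕-cong (scale-congˡ zs (coeff-≡ p zero)) (∷-cong refl (⊗-congˡ zs (∷-tail p)))

  ⊗-congʳ : ∀ xs {ys zs} → ys ≈ₚ zs → xs ⊗ ys ≈ₚ xs ⊗ zs
  ⊗-congʳ []       p = ≈ₚ-refl
  ⊗-congʳ (x ∷ xs) p = ⊕-cong (scale-cong x p) (∷-cong refl (⊗-congʳ xs p))

  ⊗-cong : ∀ {xs ys us vs} → xs ≈ₚ ys → us ≈ₚ vs → xs ⊗ us ≈ₚ ys ⊗ vs
  ⊗-cong {ys = ys} {us} p q = ≈ₚ-trans (⊗-congˡ us p) (⊗-congʳ ys q)

  ⊗-distribʳ : ∀ zs xs ys → (xs ⊕ ys) ⊗ zs ≈ₚ xs ⊗ zs ⊕ ys ⊗ zs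
  ⊗-distribʳ zs []       ys       = ≈ₚ-refl
  ⊗-distribʳ zs (x ∷ xs) []       = ≈ₚ-sym (⊕-identityʳ _)
  ⊗-distribʳ zs (x ∷ xs) (y ∷ ys) = begin
    scale (x + y) zs ⊕ (0# ∷ (xs ⊕ ys) ⊗ zs)
      ≈⟨ ⊕-cong (scale-distribʳ x y zs) (∷-cong refl (⊗-distribʳ zs xs ys)) ⟩
    (scale x zs ⊕ scale y zs) ⊕ (0# ∷ (xs ⊗ zs ⊕ ys ⊗ zs))
      ≈⟨ ⊕-cong ≈ₚ-refl (0∷-⊕ (xs ⊗ zs) (ys ⊗ zs)) ⟩
    (scale x zs ⊕ scale y zs) ⊕ ((0# ∷ xs ⊗ zs) ⊕ (0# ∷ ys ⊗ zs))
      ≈⟨ ⊕-interchange (scale x zs) (scale y zs) (0# ∷ xs ⊗ zs) (0# ∷ ys ⊗ zs) ⟩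
    (scale x zs ⊕ (0# ∷ xs ⊗ zs)) ⊕ (scale y zs ⊕ (0# ∷ ys ⊗ zs)) ∎
    where open SetoidReasoning ≈ₚ-setoid

  scale-⊗ : ∀ c xs ys → scale c xs ⊗ ys ≈ₚ scale c (xs ⊗ ys)
  scale-⊗ c []       ys = ≈ₚ-refl
  scale-⊗ c (x ∷ xs) ys = begin
    scale (c * x) ys ⊕ (0# ∷ scale c xs ⊗ ys)
      ≈⟨ ⊕-cong (scale-* c x ys) (∷-cong refl (scale-⊗ c xs ys)) ⟩
    scale c (scale x ys) ⊕ (0# ∷ scale c (xs ⊗ ys))
      ≈⟨ ⊕-cong ≈ₚ-refl (0∷-scale c (xs ⊗ ys)) ⟩
    scale c (scale x ys) ⊕ scale c (0# ∷ xs ⊗ ys)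
      ≈⟨ scale-distribˡ c (scale x ys) _ ⟨
    scale c (scale x ys ⊕ (0# ∷ xs ⊗ ys)) ∎
    where open SetoidReasoning ≈ₚ-setoid

  ⊗-assoc : ∀ xs ys zs → (xs ⊗ ys) ⊗ zs ≈ₚ xs ⊗ (ys ⊗ zs)
  ⊗-assoc []       ys zs = ≈ₚ-refl
  ⊗-assoc (x ∷ xs) ys zs = begin
    (scale x ys ⊕ (0# ∷ xs ⊗ ys)) ⊗ zs         ≈⟨ ⊗-distribʳ zs (scale x ys) _ ⟩
    scale x ys ⊗ zs ⊕ (0# ∷ xs ⊗ ys) ⊗ zs      ≈⟨ ⊕-cong (scale-⊗ x ys zs) (0∷-⊗ (xs ⊗ ys) zs) ⟩
    scale x (ys ⊗ zs) ⊕ (0# ∷ (xs ⊗ ys) ⊗ zs)  ≈⟨ ⊕-cong ≈ₚ-refl (∷-cong refl (⊗-assoc xs ys zs)) ⟩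
    scale x (ys ⊗ zs) ⊕ (0# ∷ xs ⊗ (ys ⊗ zs))  ∎
    where open SetoidReasoning ≈ₚ-setoid

  ⊗-zeroʳ : ∀ xs → IsZero (xs ⊗ [])
  ⊗-zeroʳ []       = ≈ₚ-refl
  ⊗-zeroʳ (x ∷ xs) = IsZero-0∷ (⊗-zeroʳ xs)

  ⊗-∷ʳ : ∀ xs y ys → xs ⊗ (y ∷ ys) ≈ₚ scale y xs ⊕ (0# ∷ xs ⊗ ys)
  ⊗-∷ʳ []       y ys = IsZero-0∷ ≈ₚ-refl
  ⊗-∷ʳ (x ∷ xs) y ys = ∷-cong (cong (_+ 0#) (*-comm x y)) (begin
    scale x ys ⊕ xs ⊗ (y ∷ ys)                    ≈⟨ ⊕-cong ≈ₚ-refl (⊗-∷ʳ xs y ys) ⟩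
    scale x ys ⊕ (scale y xs ⊕ (0# ∷ xs ⊗ ys))    ≈⟨ ⊕-assoc (scale x ys) (scale y xs) _ ⟨
    (scale x ys ⊕ scale y xs) ⊕ (0# ∷ xs ⊗ ys)    ≈⟨ ⊕-cong (⊕-comm (scale x ys) (scale y xs)) ≈ₚ-refl ⟩
    (scale y xs ⊕ scale x ys) ⊕ (0# ∷ xs ⊗ ys)    ≈⟨ ⊕-assoc (scale y xs) (scale x ys) _ ⟩
    scale y xs ⊕ (scale x ys ⊕ (0# ∷ xs ⊗ ys))    ∎)
    where open SetoidReasoning ≈ₚ-setoid

  ⊗-comm : ∀ xs ys → xs ⊗ ys ≈ₚ ys ⊗ xs
  ⊗-comm []       ys = ⊗-zeroʳ ys
  ⊗-comm (x ∷ xs) ys =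
    ≈ₚ-trans (⊕-cong ≈ₚ-refl (∷-cong refl (⊗-comm xs ys))) (≈ₚ-sym (⊗-∷ʳ ys x xs))

  ⊗-identityˡ : ∀ xs → const 1# ⊗ xs ≈ₚ xs
  ⊗-identityˡ xs = ≈ₚ-trans (⊕-cong ≈ₚ-refl (≈ₚ-sym (IsZero-0∷ ≈ₚ-refl))) (≈ₚ-trans (⊕-identityʳ _) (scale-1# xs))

  ⊗-distribˡ : ∀ xs ys zs → xs ⊗ (ys ⊕ zs) ≈ₚ xs ⊗ ys ⊕ xs ⊗ zs
  ⊗-distribˡ xs ys zs = begin
    xs ⊗ (ys ⊕ zs)       ≈⟨ ⊗-comm xs (ys ⊕ zs) ⟩
    (ys ⊕ zs) ⊗ xs       ≈⟨ ⊗-distribʳ xs ys zs ⟩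
    ys ⊗ xs ⊕ zs ⊗ xs    ≈⟨ ⊕-cong (⊗-comm ys xs) (⊗-comm zs xs) ⟩
    xs ⊗ ys ⊕ xs ⊗ zs    ∎
    where open SetoidReasoning ≈ₚ-setoid

  Pol-commutativeRing : CommutativeRing _ _
  Pol-commutativeRing = record
    { _≈_ = _≈ₚ_
    ; _+_ = _⊕_
    ; _*_ = _⊗_
    ; -_  = neg
    ; 0#  = []
    ; 1#  = const 1#
    ; isCommutativeRing = record
      { isRing = record
        { +-isAbelianGroup = record
          { isGroup = record
            { isMonoid = record
              { isSemigroup = CommutativeSemigroup.isSemigroup ⊕-commutativeSemigroup
              ; identity    = (λ _ → ≈ₚ-refl) , ⊕-identityʳ
              }
            ; inverse = neg-inverseˡ , neg-inverseʳ
            ; ⁻¹-cong = neg-cong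
            }
          ; comm = ⊕-comm
          }
        ; *-cong     = ⊗-cong
        ; *-assoc    = ⊗-assoc
        ; *-identity = ⊗-identityˡ , λ xs → ≈ₚ-trans (⊗-comm xs (const 1#)) (⊗-identityˡ xs)
        ; distrib    = ⊗-distribˡ , ⊗-distribʳ
        }
      ; *-comm = ⊗-comm
      }
    }

  ℤ→Pol : ℤ → Pol
  ℤ→Pol i = const (ℤ→F i)

  ℤ⟶Pol : ℤ.+-*-rawRing -Raw-AlmostCommutative⟶ fromCommutativeRing Pol-commutativeRing
  ℤ⟶Pol = record
    { ⟦_⟧    = ℤ→Pol
    ; +-homo = λ i j → ∷-cong (ℤ→F-+ i j) ≈ₚ-refl
    ; *-homo = λ i j → ∷-cong (trans (ℤ→F-* i j) (sym (+-identityʳ _))) ≈ₚ-refl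
    ; -‿homo = λ i → ∷-cong (trans (ℤ→F-neg i) (sym (-1*x≈-x _))) ≈ₚ-refl
    ; 0-homo = ≈ₚ-sym (IsZero-0∷ ≈ₚ-refl)
    ; 1-homo = ∷-cong (+-identityʳ 1#) ≈ₚ-refl
    }

  module Pol-Solver = ℤ-Solver (fromCommutativeRing Pol-commutativeRing) ℤ⟶Pol

  ·-as-⊗ : ∀ n xs → n · xs ≈ₚ ℤ→Pol (ℤ.+ n) ⊗ xs
  ·-as-⊗ n xs = ≈ₚ-sym (≈ₚ-trans (⊕-cong ≈ₚ-refl (≈ₚ-sym (IsZero-0∷ ≈ₚ-refl))) (⊕-identityʳ _))

module LeadingTerms (F : Field) where
  open Field F
  open Poly F
  open FieldArithmetic F
  open PolynomialRing F
  open CommutativeRing commutativeRing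
    using (+-comm; +-identityˡ; +-identityʳ; zeroʳ)

  record HasLead (xs : Pol) (n : ℕ) (c : Carrier) : Set where
    field
      coeff-lead  : coeff n xs ≡ c
      lead≢0      : c ≢ 0#
      coeff-above : ∀ m → n ℕ.< m → coeff m xs ≡ 0#
  open HasLead

  IsLead : Pol → Maybe (ℕ × Carrier) → Set
  IsLead xs nothing        = IsZero xs
  IsLead xs (just (n , c)) = HasLead xs n c

  lead-sound : ∀ xs → IsLead xs (lead xs)
  lead-sound []       = ≈ₚ-refl
  lead-sound (x ∷ xs) with lead xs | lead-sound xs
  ... | just (n , c) | h = record
    { coeff-lead  = coeff-lead h
    ; lead≢0      = lead≢0 h
    ; coeff-above = λ { (suc m) (ℕ.s≤s n<m) → coeff-above h m n<m }
    }
  ... | nothing | z with x ≟ 0#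
  ...   | yes x≡0 = coeffwise λ { zero → sym x≡0 ; (suc m) → coeff-≡ z m }
  ...   | no x≢0  = record
    { coeff-lead  = refl
    ; lead≢0      = x≢0
    ; coeff-above = λ { (suc m) _ → sym (coeff-≡ z m) }
    }

  HasLead-nonzero : ∀ {xs n c} → HasLead xs n c → ¬ IsZero xs
  HasLead-nonzero h z = lead≢0 h (trans (sym (coeff-lead h)) (sym (coeff-≡ z _)))

  IsLead-unique : ∀ {xs} l l′ → IsLead xs l → IsLead xs l′ → l ≡ l′
  IsLead-unique nothing        nothing        _ _ = refl
  IsLead-unique nothing        (just _)       z h = ⊥-elim (HasLead-nonzero h z)
  IsLead-unique (just _)       nothing        h z = ⊥-elim (HasLead-nonzero h z)
  IsLead-unique (just (n , c)) (just (m , e)) h h′ with ℕ.<-cmp n m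
  ... | tri< n<m _ _ = ⊥-elim (lead≢0 h′ (trans (sym (coeff-lead h′)) (coeff-above h m n<m)))
  ... | tri> _ _ m<n = ⊥-elim (lead≢0 h (trans (sym (coeff-lead h)) (coeff-above h′ n m<n)))
  ... | tri≈ _ refl _ = cong (λ e → just (n , e)) (trans (sym (coeff-lead h)) (coeff-lead h′))

  lead-complete : ∀ {xs} l → IsLead xs l → lead xs ≡ l
  lead-complete {xs} l = IsLead-unique (lead xs) l (lead-sound xs)

  IsLead-cong : ∀ {xs ys} l → xs ≈ₚ ys → IsLead xs l → IsLead ys l
  IsLead-cong nothing        p z = ≈ₚ-trans z p
  IsLead-cong (just (n , c)) p h = record
    { coeff-lead  = trans (sym (coeff-≡ p n)) (coeff-lead h)
    ; lead≢0      = lead≢0 h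
    ; coeff-above = λ m n<m → trans (sym (coeff-≡ p m)) (coeff-above h m n<m)
    }

  lead-cong : ∀ {xs ys} → xs ≈ₚ ys → lead xs ≡ lead ys
  lead-cong {xs} p = sym (lead-complete (lead xs) (IsLead-cong (lead xs) p (lead-sound xs)))

  scaleₗ : Carrier → Maybe (ℕ × Carrier) → Maybe (ℕ × Carrier)
  scaleₗ s nothing        = nothing
  scaleₗ s (just (n , c)) = just (n , s * c)

  IsLead-scale : ∀ {s xs} l → s ≢ 0# → IsLead xs l → IsLead (scale s xs) (scaleₗ s l)
  IsLead-scale {s}      nothing        s≢0 z = scale-cong s z
  IsLead-scale {s} {xs} (just (n , c)) s≢0 h = record
    { coeff-lead  = trans (coeff-scale s xs n) (cong (s *_) (coeff-lead h))
    ; lead≢0      = *-nonzero s≢0 (lead≢0 h)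
    ; coeff-above = λ m n<m →
        trans (coeff-scale s xs m) (trans (cong (s *_) (coeff-above h m n<m)) (zeroʳ s))
    }

  lead-scale : ∀ {s} xs → s ≢ 0# → lead (scale s xs) ≡ scaleₗ s (lead xs)
  lead-scale xs s≢0 = lead-complete _ (IsLead-scale (lead xs) s≢0 (lead-sound xs))

  lead-scale-0# : ∀ xs → lead (scale 0# xs) ≡ nothing
  lead-scale-0# xs = lead-complete nothing (scale-0# xs)

  infixl 7 _*ₗ_
  _*ₗ_ : Maybe (ℕ × Carrier) → Maybe (ℕ × Carrier) → Maybe (ℕ × Carrier)
  just (n , c) *ₗ just (m , e) = just (n ℕ.+ m , c * e)
  _            *ₗ _            = nothing

  HasLead-tail : ∀ {x xs n c} → HasLead (x ∷ xs) (suc n) c → HasLead xs n c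
  HasLead-tail h = record
    { coeff-lead  = coeff-lead h
    ; lead≢0      = lead≢0 h
    ; coeff-above = λ k n<k → coeff-above h (suc k) (ℕ.s≤s n<k)
    }

  HasLead-shift : ∀ {xs ys n c} m → m ℕ.≤ n → (∀ k → m ℕ.≤ k → coeff (suc k) xs ≡ coeff k ys) →
                  HasLead ys n c → HasLead xs (suc n) c
  HasLead-shift m m≤n shift h = record
    { coeff-lead  = trans (shift _ m≤n) (coeff-lead h)
    ; lead≢0      = lead≢0 h
    ; coeff-above = λ { (suc k) (ℕ.s≤s n<k) →
        trans (shift k (ℕ.≤-trans m≤n (ℕ.<⇒≤ n<k))) (coeff-above h k n<k) }
    }

  HasLead-⊗ : ∀ xs {ys n m c e} → HasLead xs n c → HasLead ys m e → HasLead (xs ⊗ ys) (n ℕ.+ m) (c * e)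
  HasLead-⊗ [] hx hy = ⊥-elim (lead≢0 hx (sym (coeff-lead hx)))
  HasLead-⊗ (x ∷ xs) {ys} {zero} {m} {c} {e} hx hy =
    IsLead-cong (just (m , c * e)) (≈ₚ-sym (begin
      scale x ys ⊕ (0# ∷ xs ⊗ ys)   ≈⟨ ⊕-cong (scale-congˡ ys (coeff-lead hx)) (≈ₚ-sym (IsZero-0∷ xs⊗ys≈0)) ⟩
      scale c ys ⊕ []                ≈⟨ ⊕-identityʳ (scale c ys) ⟩
      scale c ys                     ∎))
      (IsLead-scale (just (m , e)) (lead≢0 hx) hy)
    where
    open SetoidReasoning ≈ₚ-setoid
    xs⊗ys≈0 : IsZero (xs ⊗ ys)
    xs⊗ys≈0 = ⊗-zeroˡ {xs} ys (coeffwise λ k → sym (coeff-above hx (suc k) (ℕ.s≤s ℕ.z≤n)))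
  HasLead-⊗ (x ∷ xs) {ys} {suc n} {m} hx hy =
    HasLead-shift m (ℕ.m≤n+m m n) shift (HasLead-⊗ xs (HasLead-tail hx) hy)
    where
    shift : ∀ k → m ℕ.≤ k → coeff (suc k) ((x ∷ xs) ⊗ ys) ≡ coeff k (xs ⊗ ys)
    shift k m≤k = begin
      coeff (suc k) ((x ∷ xs) ⊗ ys)             ≡⟨ coeff-⊗-∷ x xs ys k ⟩
      x * coeff (suc k) ys + coeff k (xs ⊗ ys)  ≡⟨ cong (λ y → x * y + coeff k (xs ⊗ ys)) (coeff-above hy (suc k) (ℕ.s≤s m≤k)) ⟩
      x * 0# + coeff k (xs ⊗ ys)                ≡⟨ cong (_+ coeff k (xs ⊗ ys)) (zeroʳ x) ⟩
      0# + coeff k (xs ⊗ ys)                    ≡⟨ +-identityˡ _ ⟩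
      coeff k (xs ⊗ ys)                         ∎
      where open ≡-Reasoning

  IsLead-⊗ : ∀ {xs ys} l l′ → IsLead xs l → IsLead ys l′ → IsLead (xs ⊗ ys) (l *ₗ l′)
  IsLead-⊗ {xs} {ys} nothing  _        z _ = ⊗-zeroˡ ys z
  IsLead-⊗ {xs} {ys} (just _) nothing  _ z = ≈ₚ-trans (⊗-zeroˡ xs z) (⊗-comm ys xs)
  IsLead-⊗ {xs}      (just _) (just _) h h′ = HasLead-⊗ xs h h′

  lead-⊗ : ∀ xs ys → lead (xs ⊗ ys) ≡ lead xs *ₗ lead ys
  lead-⊗ xs ys = lead-complete _ (IsLead-⊗ (lead xs) (lead ys) (lead-sound xs) (lead-sound ys))

  Cancels : Maybe (ℕ × Carrier) → Maybe (ℕ × Carrier) → Set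
  Cancels (just (n , c)) (just (m , e)) = n ≡ m × c + e ≡ 0#
  Cancels _              _              = ⊥

  Cancels-sym : ∀ l l′ → Cancels l l′ → Cancels l′ l
  Cancels-sym (just _) (just _) (n≡m , c+e≡0) = sym n≡m , trans (+-comm _ _) c+e≡0

  coeff-⊕-≡ : ∀ xs ys k {x y z} → coeff k xs ≡ x → coeff k ys ≡ y → x + y ≡ z → coeff k (xs ⊕ ys) ≡ z
  coeff-⊕-≡ xs ys k refl refl x+y≡z = trans (coeff-⊕ xs ys k) x+y≡z

  HasLead-⊕ : ∀ {xs ys n c} l → HasLead xs n c → IsLead ys l → ¬ Cancels (just (n , c)) l →
              ∃₂ λ s e → n ℕ.≤ s × HasLead (xs ⊕ ys) s e
  HasLead-⊕ {xs} {ys} {n} {c} nothing h z _ =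
    n , c , ℕ.≤-refl , IsLead-cong (just (n , c)) xs≈xs⊕ys h
    where
    xs≈xs⊕ys : xs ≈ₚ xs ⊕ ys
    xs≈xs⊕ys = ≈ₚ-sym (≈ₚ-trans (⊕-cong ≈ₚ-refl (≈ₚ-sym z)) (⊕-identityʳ xs))
  HasLead-⊕ {xs} {ys} {n} {c} (just (m , e)) h h′ ¬cancel with ℕ.<-cmp n m
  ... | tri< n<m _ _ = m , e , ℕ.<⇒≤ n<m , record
    { coeff-lead  = coeff-⊕-≡ xs ys m (coeff-above h m n<m) (coeff-lead h′) (+-identityˡ e)
    ; lead≢0      = lead≢0 h′
    ; coeff-above = λ k m<k → coeff-⊕-≡ xs ys k (coeff-above h k (ℕ.<-trans n<m m<k)) (coeff-above h′ k m<k) (+-identityˡ 0#)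
    }
  ... | tri> _ _ m<n = n , c , ℕ.≤-refl , record
    { coeff-lead  = coeff-⊕-≡ xs ys n (coeff-lead h) (coeff-above h′ n m<n) (+-identityʳ c)
    ; lead≢0      = lead≢0 h
    ; coeff-above = λ k n<k → coeff-⊕-≡ xs ys k (coeff-above h k n<k) (coeff-above h′ k (ℕ.<-trans m<n n<k)) (+-identityˡ 0#)
    }
  ... | tri≈ _ refl _ = n , c + e , ℕ.≤-refl , record
    { coeff-lead  = trans (coeff-⊕ xs ys n) (cong₂ _+_ (coeff-lead h) (coeff-lead h′))
    ; lead≢0      = λ c+e≡0 → ¬cancel (refl , c+e≡0)
    ; coeff-above = λ k n<k → coeff-⊕-≡ xs ys k (coeff-above h k n<k) (coeff-above h′ k n<k) (+-identityˡ 0#)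
    }

  absvₗ : ℕ → Maybe (ℕ × Carrier) → ℕ
  absvₗ q nothing        = 0
  absvₗ q (just (n , _)) = q ℕ.^ n

  absv-lead : ∀ q xs → absv q xs ≡ absvₗ q (lead xs)
  absv-lead q xs with lead xs
  ... | nothing = refl
  ... | just _  = refl

  absv-cong : ∀ q {xs ys} → xs ≈ₚ ys → absv q xs ≡ absv q ys
  absv-cong q {xs} {ys} p = begin
    absv q xs              ≡⟨ absv-lead q xs ⟩
    absvₗ q (lead xs)      ≡⟨ cong (absvₗ q) (lead-cong p) ⟩
    absvₗ q (lead ys)      ≡⟨ absv-lead q ys ⟨
    absv q ys              ∎
    where open ≡-Reasoning

  absvₗ-*ₗ : ∀ q l l′ → absvₗ q (l *ₗ l′) ≡ absvₗ q l ℕ.* absvₗ q l′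
  absvₗ-*ₗ q nothing        _              = refl
  absvₗ-*ₗ q (just (n , _)) nothing        = sym (ℕ.*-zeroʳ (q ℕ.^ n))
  absvₗ-*ₗ q (just (n , _)) (just (m , _)) = ℕ.^-distribˡ-+-* q n m

  absv-⊗ : ∀ q xs ys → absv q (xs ⊗ ys) ≡ absv q xs ℕ.* absv q ys
  absv-⊗ q xs ys = begin
    absv q (xs ⊗ ys)                          ≡⟨ absv-lead q (xs ⊗ ys) ⟩
    absvₗ q (lead (xs ⊗ ys))                  ≡⟨ cong (absvₗ q) (lead-⊗ xs ys) ⟩
    absvₗ q (lead xs *ₗ lead ys)              ≡⟨ absvₗ-*ₗ q (lead xs) (lead ys) ⟩
    absvₗ q (lead xs) ℕ.* absvₗ q (lead ys)   ≡⟨ cong₂ ℕ._*_ (absv-lead q xs) (absv-lead q ys) ⟨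
    absv q xs ℕ.* absv q ys                   ∎
    where open ≡-Reasoning

  absvₗ-scaleₗ : ∀ q s l → absvₗ q (scaleₗ s l) ≡ absvₗ q l
  absvₗ-scaleₗ q s nothing  = refl
  absvₗ-scaleₗ q s (just _) = refl

  absv-scale : ∀ q {s} xs → s ≢ 0# → absv q (scale s xs) ≡ absv q xs
  absv-scale q {s} xs s≢0 = begin
    absv q (scale s xs)           ≡⟨ absv-lead q (scale s xs) ⟩
    absvₗ q (lead (scale s xs))   ≡⟨ cong (absvₗ q) (lead-scale xs s≢0) ⟩
    absvₗ q (scaleₗ s (lead xs))  ≡⟨ absvₗ-scaleₗ q s (lead xs) ⟩
    absvₗ q (lead xs)             ≡⟨ absv-lead q xs ⟨
    absv q xs                     ∎
    where open ≡-Reasoning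

  absv-scale-≤ : ∀ q s xs → absv q (scale s xs) ℕ.≤ absv q xs
  absv-scale-≤ q s xs with s ≟ 0#
  ... | yes refl = ℕ.≤-trans (ℕ.≤-reflexive absv≡0) ℕ.z≤n
    where
    absv≡0 : absv q (scale 0# xs) ≡ 0
    absv≡0 = trans (absv-lead q (scale 0# xs)) (cong (absvₗ q) (lead-scale-0# xs))
  ... | no s≢0   = ℕ.≤-reflexive (absv-scale q xs s≢0)

  absv-⊕ˡ : ∀ q .{{_ : ℕ.NonZero q}} xs ys → ¬ Cancels (lead xs) (lead ys) → absv q xs ℕ.≤ absv q (xs ⊕ ys)
  absv-⊕ˡ q xs ys ¬cancel rewrite absv-lead q xs | absv-lead q (xs ⊕ ys)
    with lead xs | lead-sound xs
  ... | nothing      | _ = ℕ.z≤n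
  ... | just (n , c) | h with HasLead-⊕ (lead ys) h (lead-sound ys) ¬cancel
  ...   | s , e , n≤s , h⁺ rewrite lead-complete (just (s , e)) h⁺ = ℕ.^-monoʳ-≤ q n≤s

  absv-⊕ʳ : ∀ q .{{_ : ℕ.NonZero q}} xs ys → ¬ Cancels (lead xs) (lead ys) → absv q ys ℕ.≤ absv q (xs ⊕ ys)
  absv-⊕ʳ q xs ys ¬cancel = ℕ.≤-trans
    (absv-⊕ˡ q ys xs (λ c → ¬cancel (Cancels-sym (lead ys) (lead xs) c)))
    (ℕ.≤-reflexive (absv-cong q (⊕-comm ys xs)))

module CubicForm (F : Field) (a b c d : Poly.Pol F) where
  open Field F
  open Poly F
  open FieldArithmetic F
  open PolynomialRing F
  open LeadingTerms F

  private
    P U D Δ B : Pol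
    P = hesP a b c d
    U = Uf a b c d
    D = disc a b c d
    Δ = hesDisc a b c d
    B = neg (9 · (a ⊗ a ⊗ Δ))

    n̂ : ℕ → Pol
    n̂ n = ℤ→Pol (ℤ.+ n)

    -- The same polynomials with every n · _ replaced by a product with the constant n,
    -- which is the form the ring solver works with.
    P′ D′ Δ′ U′ : Pol
    P′ = b ⊗ b ⊕ neg (n̂ 3 ⊗ (a ⊗ c))
    D′ = n̂ 18 ⊗ (a ⊗ b ⊗ c ⊗ d) ⊕ b ⊗ b ⊗ c ⊗ c ⊕ neg (n̂ 4 ⊗ (a ⊗ c ⊗ c ⊗ c))
         ⊕ neg (n̂ 4 ⊗ (b ⊗ b ⊗ b ⊗ d)) ⊕ neg (n̂ 27 ⊗ (a ⊗ a ⊗ d ⊗ d))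
    Δ′ = neg (n̂ 3 ⊗ D′)
    U′ = n̂ 2 ⊗ (b ⊗ b ⊗ b) ⊕ n̂ 27 ⊗ (a ⊗ a ⊗ d) ⊕ neg (n̂ 9 ⊗ (a ⊗ b ⊗ c))

    P≈P′ : P ≈ₚ P′
    P≈P′ = ⊕-cong (≈ₚ-refl {b ⊗ b}) (neg-cong (·-as-⊗ 3 (a ⊗ c)))

    D≈D′ : D ≈ₚ D′
    D≈D′ = ⊕-cong (⊕-cong (⊕-cong (⊕-cong (·-as-⊗ 18 (a ⊗ b ⊗ c ⊗ d)) (≈ₚ-refl {b ⊗ b ⊗ c ⊗ c}))
                                    (neg-cong (·-as-⊗ 4 (a ⊗ c ⊗ c ⊗ c))))
                            (neg-cong (·-as-⊗ 4 (b ⊗ b ⊗ b ⊗ d))))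
                   (neg-cong (·-as-⊗ 27 (a ⊗ a ⊗ d ⊗ d)))

    Δ≈Δ′ : Δ ≈ₚ Δ′
    Δ≈Δ′ = neg-cong (≈ₚ-trans (·-as-⊗ 3 D) (⊗-congʳ (n̂ 3) D≈D′))

    U≈U′ : U ≈ₚ U′
    U≈U′ = ⊕-cong (⊕-cong (·-as-⊗ 2 (b ⊗ b ⊗ b)) (·-as-⊗ 27 (a ⊗ a ⊗ d))) (neg-cong (·-as-⊗ 9 (a ⊗ b ⊗ c)))

    syzygy′ : n̂ 4 ⊗ (P′ ⊗ P′ ⊗ P′) ≈ₚ U′ ⊗ U′ ⊕ neg (n̂ 9 ⊗ (a ⊗ a ⊗ Δ′))
    syzygy′ = solve 4 (λ a b c d →
      let P = b :* b :- con (ℤ.+ 3) :* (a :* c)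
          D = con (ℤ.+ 18) :* (a :* b :* c :* d) :+ b :* b :* c :* c :- con (ℤ.+ 4) :* (a :* c :* c :* c)
              :- con (ℤ.+ 4) :* (b :* b :* b :* d) :- con (ℤ.+ 27) :* (a :* a :* d :* d)
          U = con (ℤ.+ 2) :* (b :* b :* b) :+ con (ℤ.+ 27) :* (a :* a :* d) :- con (ℤ.+ 9) :* (a :* b :* c)
      in con (ℤ.+ 4) :* (P :* P :* P) := U :* U :- con (ℤ.+ 9) :* (a :* a :* (:- (con (ℤ.+ 3) :* D))))
      ≈ₚ-refl a b c d
      where open Pol-Solver

  hessian-syzygy : 4 · (P ⊗ P ⊗ P) ≈ₚ U ⊗ U ⊕ B
  hessian-syzygy = begin
    4 · (P ⊗ P ⊗ P)                    ≈⟨ ·-as-⊗ 4 (P ⊗ P ⊗ P) ⟩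
    n̂ 4 ⊗ (P ⊗ P ⊗ P)                  ≈⟨ ⊗-congʳ (n̂ 4) (⊗-cong (⊗-cong P≈P′ P≈P′) P≈P′) ⟩
    n̂ 4 ⊗ (P′ ⊗ P′ ⊗ P′)               ≈⟨ syzygy′ ⟩
    U′ ⊗ U′ ⊕ neg (n̂ 9 ⊗ (a ⊗ a ⊗ Δ′)) ≈⟨ ⊕-cong (⊗-cong U≈U′ U≈U′) (neg-cong (⊗-congʳ (n̂ 9) (⊗-congʳ (a ⊗ a) Δ≈Δ′))) ⟨
    U ⊗ U ⊕ neg (n̂ 9 ⊗ (a ⊗ a ⊗ Δ))    ≈⟨ ⊕-cong (≈ₚ-refl {U ⊗ U}) (neg-cong (·-as-⊗ 9 (a ⊗ a ⊗ Δ))) ⟨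
    U ⊗ U ⊕ B                           ∎
    where open SetoidReasoning ≈ₚ-setoid

  OddOrNonSquare : ℕ → Carrier → Set
  OddOrNonSquare δ cΔ = (∃ λ k → δ ≡ suc (2 ℕ.* k)) ⊎ ¬ IsSquare cΔ

  hesDisc-lead : HessianImaginary a b c d ⊎ HessianUnusual a b c d →
                 ∃₂ λ δ cΔ → lead Δ ≡ just (δ , cΔ) × OddOrNonSquare δ cΔ
  hesDisc-lead (inj₁ (k , cΔ , eq))       = suc (2 ℕ.* k) , cΔ , eq , inj₁ (k , refl)
  hesDisc-lead (inj₂ (k , cΔ , eq , ¬sq)) = 2 ℕ.* k , cΔ , eq , inj₂ ¬sq

  hesDisc-nonzero : HessianImaginary a b c d ⊎ HessianUnusual a b c d → ¬ IsZeroPol Δ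
  hesDisc-nonzero hyp Δ≡0 with hesDisc-lead hyp
  ... | _ , _ , eq , _ = case trans (sym eq) Δ≡0 of λ ()

  natF3≢0 : ¬ IsZeroPol Δ → natF 3 ≢ 0#
  natF3≢0 Δ≢0 3≡0 = Δ≢0 (lead-complete nothing
    (subst (λ t → IsZero (neg (scale t D))) (sym 3≡0) (scale-cong (- 1#) (scale-0# D))))

  natF9≢0 : ¬ IsZeroPol Δ → natF 9 ≢ 0#
  natF9≢0 Δ≢0 9≡0 = *-nonzero (natF3≢0 Δ≢0) (natF3≢0 Δ≢0) (trans (sym (natF-* 3 3)) 9≡0)

  lead-B : natF 9 ≢ 0# → lead B ≡ scaleₗ (- 1#) (scaleₗ (natF 9) (lead a *ₗ lead a *ₗ lead Δ))
  lead-B 9≢0 = begin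
    lead B                                                      ≡⟨ lead-scale (9 · (a ⊗ a ⊗ Δ)) -1#≢0# ⟩
    scaleₗ (- 1#) (lead (9 · (a ⊗ a ⊗ Δ)))                      ≡⟨ cong (scaleₗ (- 1#)) (lead-scale (a ⊗ a ⊗ Δ) 9≢0) ⟩
    scaleₗ (- 1#) (scaleₗ (natF 9) (lead (a ⊗ a ⊗ Δ)))          ≡⟨ cong (λ l → scaleₗ (- 1#) (scaleₗ (natF 9) l)) (trans (lead-⊗ (a ⊗ a) Δ) (cong (_*ₗ lead Δ) (lead-⊗ a a))) ⟩
    scaleₗ (- 1#) (scaleₗ (natF 9) (lead a *ₗ lead a *ₗ lead Δ)) ∎
    where open ≡-Reasoning

  leading-terms-don't-cancel : natF 3 ≢ 0# → ∀ lU {xs} la → IsLead xs la → ∀ {δ cΔ} → OddOrNonSquare δ cΔ →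
    ¬ Cancels (lU *ₗ lU) (scaleₗ (- 1#) (scaleₗ (natF 9) (la *ₗ la *ₗ just (δ , cΔ))))
  leading-terms-don't-cancel _ nothing  _        _ _ ()
  leading-terms-don't-cancel _ (just _) nothing  _ _ ()
  leading-terms-don't-cancel _ (just (u , _)) (just (α , _)) _ (inj₁ (k , refl)) (2u≡2α+δ , _) =
    ℕ.even≢odd u (α ℕ.+ k) (begin
      2 ℕ.* u                          ≡⟨ cong (u ℕ.+_) (ℕ.+-identityʳ u) ⟩
      u ℕ.+ u                          ≡⟨ 2u≡2α+δ ⟩
      (α ℕ.+ α) ℕ.+ suc (2 ℕ.* k)      ≡⟨ even+odd α k ⟩
      suc (2 ℕ.* (α ℕ.+ k))            ∎)
    where
    open ≡-Reasoning
    even+odd : ∀ m n → (m ℕ.+ m) ℕ.+ suc (2 ℕ.* n) ≡ suc (2 ℕ.* (m ℕ.+ n))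
    even+odd = solve-∀
  leading-terms-don't-cancel 3≢0 (just _) (just _) ha (inj₂ ¬sq) (_ , c+e≡0) =
    ¬sq (u*u≡9*a*a*c⇒IsSquare 3≢0 (HasLead.lead≢0 ha) (x+-1*y≡0⇒x≡y c+e≡0))

  U⊗U-B-don't-cancel : HessianImaginary a b c d ⊎ HessianUnusual a b c d → ¬ Cancels (lead (U ⊗ U)) (lead B)
  U⊗U-B-don't-cancel hyp =
    let δ , cΔ , eq , kind = hesDisc-lead hyp
        Δ≢0 = hesDisc-nonzero hyp
    in subst₂ (λ l l′ → ¬ Cancels l l′) (sym (lead-⊗ U U))
         (sym (trans (lead-B (natF9≢0 Δ≢0)) (cong (λ l → scaleₗ (- 1#) (scaleₗ (natF 9) (lead a *ₗ lead a *ₗ l))) eq)))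
         (leading-terms-don't-cancel (natF3≢0 Δ≢0) (lead U) (lead a) (lead-sound a) kind)

  absv-U⊗U⊕B≤absv-P³ : ∀ q → absv q (U ⊗ U ⊕ B) ℕ.≤ absv q P ℕ.^ 3
  absv-U⊗U⊕B≤absv-P³ q = begin
    absv q (U ⊗ U ⊕ B)                     ≡⟨ absv-cong q hessian-syzygy ⟨
    absv q (4 · (P ⊗ P ⊗ P))               ≤⟨ absv-scale-≤ q (natF 4) (P ⊗ P ⊗ P) ⟩
    absv q (P ⊗ P ⊗ P)                     ≡⟨ trans (absv-⊗ q (P ⊗ P) P) (cong (ℕ._* absv q P) (absv-⊗ q P P)) ⟩
    (absv q P ℕ.* absv q P) ℕ.* absv q P   ≡⟨ cube (absv q P) ⟩
    absv q P ℕ.^ 3                         ∎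
    where
    open ℕ.≤-Reasoning
    cube : ∀ x → (x ℕ.* x) ℕ.* x ≡ x ℕ.^ 3
    cube x = trans (ℕ.*-assoc x x x) (cong (λ y → x ℕ.* (x ℕ.* y)) (sym (ℕ.*-identityʳ x)))

  absv-U²≤absv-P³ : ∀ q .{{_ : ℕ.NonZero q}} → HessianImaginary a b c d ⊎ HessianUnusual a b c d →
                    absv q U ℕ.^ 2 ℕ.≤ absv q P ℕ.^ 3
  absv-U²≤absv-P³ q hyp = begin
    absv q U ℕ.^ 2              ≡⟨ cong (absv q U ℕ.*_) (ℕ.*-identityʳ (absv q U)) ⟩
    absv q U ℕ.* absv q U       ≡⟨ absv-⊗ q U U ⟨
    absv q (U ⊗ U)              ≤⟨ absv-⊕ˡ q (U ⊗ U) B (U⊗U-B-don't-cancel hyp) ⟩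
    absv q (U ⊗ U ⊕ B)          ≤⟨ absv-U⊗U⊕B≤absv-P³ q ⟩
    absv q P ℕ.^ 3              ∎
    where open ℕ.≤-Reasoning

  absv-a²D≡absv-B : ∀ q → ¬ IsZeroPol Δ → absv q (a ⊗ a ⊗ D) ≡ absv q B
  absv-a²D≡absv-B q Δ≢0 = begin
    absv q (a ⊗ a ⊗ D)                 ≡⟨ absv-⊗ q (a ⊗ a) D ⟩
    absv q (a ⊗ a) ℕ.* absv q D        ≡⟨ cong (absv q (a ⊗ a) ℕ.*_) absv-Δ≡absv-D ⟨
    absv q (a ⊗ a) ℕ.* absv q Δ        ≡⟨ absv-⊗ q (a ⊗ a) Δ ⟨
    absv q (a ⊗ a ⊗ Δ)                 ≡⟨ absv-scale q (a ⊗ a ⊗ Δ) (natF9≢0 Δ≢0) ⟨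
    absv q (9 · (a ⊗ a ⊗ Δ))           ≡⟨ absv-scale q (9 · (a ⊗ a ⊗ Δ)) -1#≢0# ⟨
    absv q B                           ∎
    where
    open ≡-Reasoning
    absv-Δ≡absv-D : absv q Δ ≡ absv q D
    absv-Δ≡absv-D = trans (absv-scale q (3 · D) -1#≢0#) (absv-scale q D (natF3≢0 Δ≢0))

  absv-a²D≤absv-P³ : ∀ q .{{_ : ℕ.NonZero q}} → HessianImaginary a b c d ⊎ HessianUnusual a b c d →
                     absv q (a ⊗ a ⊗ D) ℕ.≤ absv q P ℕ.^ 3
  absv-a²D≤absv-P³ q hyp = begin
    absv q (a ⊗ a ⊗ D)          ≡⟨ absv-a²D≡absv-B q (hesDisc-nonzero hyp) ⟩
    absv q B                    ≤⟨ absv-⊕ʳ q (U ⊗ U) B (U⊗U-B-don't-cancel hyp) ⟩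
    absv q (U ⊗ U ⊕ B)          ≤⟨ absv-U⊗U⊕B≤absv-P³ q ⟩
    absv q P ℕ.^ 3              ∎
    where open ℕ.≤-Reasoning

corollary5p2 :
    (p k q : ℕ) → Prime p → 5 ≤ p → 1 ≤ k → q ≡ p ^ k →
    (F : Field) → (Fin q ↔ Field.Carrier F) →
    let open Poly F in
    (a b c d : Pol) →
    ¬ IsZeroPol (disc a b c d) →
    (HessianImaginary a b c d ⊎ HessianUnusual a b c d) →
    (absv q (Uf a b c d) ^ 2 ≤ absv q (hesP a b c d) ^ 3)
    × (absv q (a ⊗ a ⊗ disc a b c d) ≤ absv q (hesP a b c d) ^ 3)
corollary5p2 p k .(p ^ k) _ 5≤p _ refl F _ a b c d _ hyp =
  absv-U²≤absv-P³ (p ^ k) hyp , absv-a²D≤absv-P³ (p ^ k) hyp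
  where
  open CubicForm F a b c d
  instance
    p≢0 : ℕ.NonZero p
    p≢0 = ℕ.>-nonZero (ℕ.≤-trans (ℕ.s≤s ℕ.z≤n) 5≤p)
    q≢0 : ℕ.NonZero (p ^ k)
    q≢0 = ℕ.m^n≢0 p k
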